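{- Let $G$ be a finite group, $m>1$, and $\Gamma=\mathrm{Cay}(G,S_{i,j}:1\le i,j\le m)$ an $m$-PCayley digraph of $G$. Then $\Gamma$ is K$m$PCI if and only if $N_{\mathrm{Aut}(\Gamma)}(R(G))$ induces the full symmetric group on $\mathcal{G}=\{G_1,\dots,G_m\}$ and every semiregular subgroup of $\mathrm{Aut}(\Gamma)$ which is isomorphic to $G$ and has orbit set $\mathcal{G}$ is conjugate to $R(G)$ in $\mathrm{Aut}(\Gamma)$.
   Context: For subsets $S_{i,j}\subseteq G$, $\mathrm{Cay}(G,S_{i,j}:1\le i,j\le m)$ is the digraph with vertex set $\bigcup_i G_i$, $G_i=\{x_i:x\in G\}$, and arcs $(x_i,(sx)_j)$ for $s\in S_{i,j}$, $x\in G$; it is an $m$-PCayley digraph of $G$ if $S_{i,i}=\emptyset$ for all $i$ (all on the same vertex set). $R(g):x_i\mapsto(xg)_i$, $R(G)=\{R(g)\}$, with orbit set $\mathcal{G}$. A permutation group is semiregular if all point stabilizers are trivial. $N$ is the normalizer of $R(G)$ in the symmetric group on the vertex set and $K$ the kernel of $N$ acting on $\mathcal{G}$. $\Gamma$ is K$m$PCI if for every $m$-PCayley digraph $\Sigma$ of $G$ such that some isomorphism $\Gamma\to\Sigma$ maps $\mathcal{G}$ to itself, there exists $k\in K$ with $\Gamma^k=\Sigma$. -}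

module Defs where

open import Data.Nat using (ℕ)
open import Data.Fin using (Fin)
open import Data.Fin.Subset using (Subset; _∈_) renaming (⊥ to ∅)
open import Data.Fin.Permutation using (Permutation′; _⟨$⟩ʳ_)
open import Data.Product using (Σ; ∃; _×_; _,_; proj₁; proj₂)
open import Function.Bundles using (_↔_; Inverse; _⇔_)
open import Relation.Binary.PropositionalEquality using (_≡_)
open import Algebra.Structures using (IsGroup)

-- A finite group: carrier Fin order, with propositional equality.
-- (Every finite group is isomorphic to one of this form.)

record FinGroup : Set where
  field
    order   : ℕ
    _∙_     : Fin order → Fin order → Fin order
    ε       : Fin order
    _⁻¹     : Fin order → Fin order
    isGroup : IsGroup _≡_ _∙_ ε _⁻¹

module Cayley (G : FinGroup) (m : ℕ) where
  open FinGroup G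

  Carrier : Set
  Carrier = Fin order

  -- vertex x_i is represented by (x , i)
  V : Set
  V = Carrier × Fin m

  Conn : Set
  Conn = Fin m → Fin m → Subset order

  Arc : Conn → V → V → Set
  Arc S (x , i) (y , j) = Σ Carrier λ s → (s ∈ S i j) × (y ≡ s ∙ x)

  IsPCayley : Conn → Set
  IsPCayley S = ∀ i → S i i ≡ ∅

  Perm : Set
  Perm = V ↔ V

  ap : Perm → V → V
  ap = Inverse.to

  apInv : Perm → V → V
  apInv = Inverse.from

  _≈ₚ_ : Perm → Perm → Set
  σ ≈ₚ τ = ∀ v → ap σ v ≡ ap τ v

  R : Carrier → V → V
  R g (x , i) = (x ∙ g , i)

  IsIso : Conn → Conn → Perm → Set
  IsIso S T f = ∀ u v → Arc S u v ⇔ Arc T (ap f u) (ap f v)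

  InAut : Conn → Perm → Set
  InAut S σ = IsIso S S σ

  -- σ normalises R(G):  σ R(G) σ⁻¹ = R(G), i.e. σ R(g) = R(h) σ
  Normalises : Perm → Set
  Normalises σ =
    (∀ g → ∃ λ h → ∀ v → ap σ (R g v) ≡ R h (ap σ v)) ×
    (∀ h → ∃ λ g → ∀ v → ap σ (R g v) ≡ R h (ap σ v))

  -- K : kernel of N = N_{Sym(V)}(R(G)) acting on 𝒢 = {G_1,…,G_m}
  InK : Perm → Set
  InK σ = Normalises σ × (∀ x i → proj₂ (ap σ (x , i)) ≡ i)

  MapsOrbitsToOrbits : Perm → Set
  MapsOrbitsToOrbits f =
    ∀ i → ∃ λ j → (∀ x → proj₂ (ap f (x , i)) ≡ j) ×
                  (∀ y → ∃ λ x → ap f (x , i) ≡ (y , j))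

  ImageIs : Conn → Perm → Conn → Set
  ImageIs S k T = ∀ u v → Arc S u v ⇔ Arc T (ap k u) (ap k v)

  KmPCI : Conn → Set
  KmPCI S = ∀ (T : Conn) → IsPCayley T →
            (∃ λ f → IsIso S T f × MapsOrbitsToOrbits f) →
            ∃ λ k → InK k × ImageIs S k T

  InducesFullSym : Conn → Set
  InducesFullSym S = ∀ (π : Permutation′ m) →
    ∃ λ σ → InAut S σ × Normalises σ ×
            (∀ x i → proj₂ (ap σ (x , i)) ≡ π ⟨$⟩ʳ i)

  SubgroupIsoToG : (Perm → Set) → Set
  SubgroupIsoToG H =
    Σ (Carrier → Perm) λ φ →
      (∀ σ → H σ ⇔ (∃ λ g → φ g ≈ₚ σ)) ×
      (∀ g h v → ap (φ (g ∙ h)) v ≡ ap (φ g) (ap (φ h) v)) ×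
      (∀ g h → φ g ≈ₚ φ h → g ≡ h)

  Semiregular : (Perm → Set) → Set
  Semiregular H = ∀ σ → H σ → ∀ v → ap σ v ≡ v → ∀ w → ap σ w ≡ w

  HasOrbitSet𝒢 : (Perm → Set) → Set
  HasOrbitSet𝒢 H = ∀ u v → (∃ λ σ → H σ × ap σ u ≡ v) ⇔ (proj₂ u ≡ proj₂ v)

  ConjugateToR : (Perm → Set) → Perm → Set
  ConjugateToR H τ =
    (∀ σ → H σ → ∃ λ g → ∀ v → apInv τ (ap σ (ap τ v)) ≡ R g v) ×
    (∀ g → ∃ λ σ → H σ × (∀ v → apInv τ (ap σ (ap τ v)) ≡ R g v))

  SemiregularSubgroupsConjugate : Conn → Set₁
  SemiregularSubgroupsConjugate S =
    ∀ (H : Perm → Set) →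
      (∀ σ → H σ → InAut S σ) →
      SubgroupIsoToG H →
      Semiregular H →
      HasOrbitSet𝒢 H →
      ∃ λ τ → InAut S τ × ConjugateToR H τ

-- If Γ is KmPCI, relabelling the blocks G_i by any permutation π gives an m-PCayley
-- digraph isomorphic to Γ by a block-respecting map, so some k ∈ K realises it and
-- k⁻¹ ∘ relabel(π) lies in N_Aut(Γ)(R(G)) and induces π. A semiregular H ≅ G with
-- orbits G_i yields coordinates (g , i) ↦ φ(g⁻¹)(1 , i) in which H becomes R(G) and Γ
-- becomes another m-PCayley digraph Σ; the k ∈ K with Γ^k = Σ then conjugates H to R(G).
-- Conversely, given a block-respecting isomorphism f : Γ → Σ, the group f⁻¹ R(G) f is
-- such an H, so some τ ∈ Aut(Γ) makes f ∘ τ normalise R(G); correcting its action on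
-- the blocks by an element of N_Aut(Γ)(R(G)) inducing the same permutation puts it in K.

module Submission where

open import Defs
open import Algebra.Bundles using (Group)
import Algebra.Properties.Group as GroupProperties
open import Data.Bool using (false)
open import Data.Fin using (Fin; zero)
open import Data.Fin.Subset using (Subset; _∈_) renaming (⊥ to ∅)
open import Data.Fin.Permutation using (Permutation′; _⟨$⟩ʳ_; _⟨$⟩ˡ_)
import Data.Fin.Permutation as Permutation
open import Data.Nat using (ℕ; suc; _<_)
open import Data.Product using (∃; _×_; _,_; proj₁; proj₂)
open import Data.Vec using (lookup; tabulate)
open import Data.Vec.Properties
  using (lookup∘tabulate; tabulate∘lookup; tabulate-cong; lookup-replicate; []=⇒lookup; lookup⇒[]=)
open import Function.Base using (id; _∘_)
open import Function.Bundles using (Inverse; _⇔_; mk⇔; mk↔ₛ′; Equivalence)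
open import Function.Construct.Composition using (_↔-∘_)
open import Function.Construct.Symmetry using (↔-sym)
open import Function.Properties.Equivalence using (⇔-setoid)
open import Level using (0ℓ)
open import Relation.Binary.PropositionalEquality

preimage : ∀ {n k} → (Fin n → Fin k) → Subset k → Subset n
preimage f A = tabulate (lookup A ∘ f)

∈-preimage : ∀ {n k} (f : Fin n → Fin k) (A : Subset k) {s : Fin n} → s ∈ preimage f A ⇔ f s ∈ A
∈-preimage f A {s} = mk⇔
  (λ s∈ → lookup⇒[]= (f s) A (trans (sym (lookup∘tabulate (lookup A ∘ f) s)) ([]=⇒lookup s∈)))
  (λ fs∈ → lookup⇒[]= s (preimage f A) (trans (lookup∘tabulate (lookup A ∘ f) s) ([]=⇒lookup fs∈)))

preimage-∅ : ∀ {n k} (f : Fin n → Fin k) → preimage f ∅ ≡ ∅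
preimage-∅ f = trans
  (tabulate-cong λ s → trans (lookup-replicate (f s) false) (sym (lookup-replicate s false)))
  (tabulate∘lookup ∅)

module CayleyDigraphs (G : FinGroup) (m : ℕ) where
  open Cayley G m

  group : Group 0ℓ 0ℓ
  group = record
    { Carrier = Carrier ; _≈_ = _≡_ ; _∙_ = FinGroup._∙_ G ; ε = FinGroup.ε G
    ; _⁻¹ = FinGroup._⁻¹ G ; isGroup = FinGroup.isGroup G }

  open Group group using (_∙_; ε; _⁻¹; _//_; _\\_; assoc; identityˡ; identityʳ; inverseˡ; inverseʳ)
  open GroupProperties group
    using ( ∙-cancelˡ; ∙-cancelʳ; ⁻¹-involutive; ⁻¹-anti-homo-∙; ⁻¹-injective; ε⁻¹≈ε
          ; inverseˡ-unique; identityʳ-unique; \\-leftDividesˡ; //-rightDividesˡ; //-rightDividesʳ)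

  ap-apInv : (σ : Perm) → ∀ v → ap σ (apInv σ v) ≡ v
  ap-apInv = Inverse.strictlyInverseˡ

  apInv-ap : (σ : Perm) → ∀ v → apInv σ (ap σ v) ≡ v
  apInv-ap = Inverse.strictlyInverseʳ

  IsIso-∘ : ∀ {A B C f g} → IsIso A B f → IsIso B C g → IsIso A C (g ↔-∘ f)
  IsIso-∘ {f = f} f-iso g-iso u v = mk⇔
    (Equivalence.to (g-iso (ap f u) (ap f v)) ∘ Equivalence.to (f-iso u v))
    (Equivalence.from (f-iso u v) ∘ Equivalence.from (g-iso (ap f u) (ap f v)))

  IsIso-sym : ∀ {A B f} → IsIso A B f → IsIso B A (↔-sym f)
  IsIso-sym {A} {B} {f} f-iso u v = mk⇔
    (λ a → Equivalence.from (f-iso (apInv f u) (apInv f v))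
             (subst₂ (Arc B) (sym (ap-apInv f u)) (sym (ap-apInv f v)) a))
    (λ b → subst₂ (Arc B) (ap-apInv f u) (ap-apInv f v)
             (Equivalence.to (f-iso (apInv f u) (apInv f v)) b))

  IsIso-resp-≈ₚ : ∀ {A B σ τ} → σ ≈ₚ τ → IsIso A B σ → IsIso A B τ
  IsIso-resp-≈ₚ {A} {B} σ≈τ σ-iso u v = mk⇔
    (subst₂ (Arc B) (σ≈τ u) (σ≈τ v) ∘ Equivalence.to (σ-iso u v))
    (Equivalence.from (σ-iso u v) ∘ subst₂ (Arc B) (sym (σ≈τ u)) (sym (σ≈τ v)))

  Arc⇔// : ∀ T {x y i j} → Arc T (x , i) (y , j) ⇔ y // x ∈ T i j
  Arc⇔// T {x} {y} {i} {j} = mk⇔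
    (λ { (s , s∈ , y≡sx) → subst (_∈ T i j) (sym (trans (cong (_// x) y≡sx) (//-rightDividesʳ x s))) s∈ })
    (λ y/x∈ → y // x , y/x∈ , sym (//-rightDividesˡ x y))

  Arc-fromε⇔∈ : ∀ T {y i j} → Arc T (ε , i) (y , j) ⇔ y ∈ T i j
  Arc-fromε⇔∈ T {y} {i} {j} = mk⇔
    (λ { (s , s∈ , y≡sε) → subst (_∈ T i j) (sym (trans y≡sε (identityʳ s))) s∈ })
    (λ y∈ → y , y∈ , sym (identityʳ y))

  R-∘ : ∀ g h v → R g (R h v) ≡ R (h ∙ g) v
  R-∘ g h (x , i) = cong (_, i) (assoc x h g)

  R-ε : ∀ v → R ε v ≡ v
  R-ε (x , i) = cong (_, i) (identityʳ x)

  R-injective : ∀ {g h} v → R g v ≡ R h v → g ≡ h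
  R-injective (x , i) e = ∙-cancelˡ x _ _ (cong proj₁ e)

  R-fixes⇒≡ε : ∀ {g} v → R g v ≡ v → g ≡ ε
  R-fixes⇒≡ε (x , i) e = identityʳ-unique x _ (cong proj₁ e)

  R-transitive : ∀ {u v} → proj₂ u ≡ proj₂ v → ∃ λ g → R g u ≡ v
  R-transitive {x , i} {y , j} i≡j = x \\ y , cong₂ _,_ (\\-leftDividesˡ x y) i≡j

  Rp : Carrier → Perm
  Rp g = mk↔ₛ′ (R g) (R (g ⁻¹))
    (λ v → trans (R-∘ g (g ⁻¹) v) (trans (cong (λ h → R h v) (inverseˡ g)) (R-ε v)))
    (λ v → trans (R-∘ (g ⁻¹) g v) (trans (cong (λ h → R h v) (inverseʳ g)) (R-ε v)))

  Rp-inAut : ∀ T g → InAut T (Rp g)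
  Rp-inAut T g (x , i) (y , j) = mk⇔
    (λ { (s , s∈ , y≡sx) → s , s∈ , trans (cong (_∙ g) y≡sx) (assoc s x g) })
    (λ { (s , s∈ , yg≡sxg) →
         s , s∈ , ∙-cancelʳ g y (s ∙ x) (trans yg≡sxg (sym (assoc s x g))) })

  Intertwines : Perm → (V → V) → (V → V) → Set
  Intertwines τ α β = ∀ v → ap τ (α v) ≡ β (ap τ v)

  Intertwines-∘ : ∀ {σ τ α β γ} → Intertwines σ α β → Intertwines τ β γ → Intertwines (τ ↔-∘ σ) α γ
  Intertwines-∘ {σ} {τ} σαβ τβγ v = trans (cong (ap τ) (σαβ v)) (τβγ (ap σ v))

  Intertwines-sym : ∀ {τ α β} → Intertwines τ α β → Intertwines (↔-sym τ) β α
  Intertwines-sym {τ} {α} {β} ταβ w = begin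
    apInv τ (β w)                   ≡⟨ cong (apInv τ ∘ β) (ap-apInv τ w) ⟨
    apInv τ (β (ap τ (apInv τ w)))  ≡⟨ cong (apInv τ) (ταβ (apInv τ w)) ⟨
    apInv τ (ap τ (α (apInv τ w)))  ≡⟨ apInv-ap τ _ ⟩
    α (apInv τ w)                   ∎
    where open ≡-Reasoning

  Intertwines-respʳ : ∀ {τ α β β′} → β ≗ β′ → Intertwines τ α β → Intertwines τ α β′
  Intertwines-respʳ {τ} β≗β′ ταβ v = trans (ταβ v) (β≗β′ (ap τ v))

  Intertwines⇒conjugate : ∀ {τ α β} → Intertwines τ α β → ∀ v → apInv τ (β (ap τ v)) ≡ α v
  Intertwines⇒conjugate {τ} {α} {β} ταβ v =
    trans (Intertwines-sym {τ} {α} {β} ταβ (ap τ v)) (cong α (apInv-ap τ v))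

  conjugate⇒Intertwines : ∀ {τ α β} → (∀ v → apInv τ (β (ap τ v)) ≡ α v) → Intertwines τ α β
  conjugate⇒Intertwines {τ} {α} {β} conj v =
    trans (cong (ap τ) (sym (conj v))) (ap-apInv τ (β (ap τ v)))

  Normalises-∘ : ∀ {σ τ} → Normalises σ → Normalises τ → Normalises (τ ↔-∘ σ)
  Normalises-∘ {σ} {τ} (σ₁ , σ₂) (τ₁ , τ₂) =
    (λ g → let (h , σgh) = σ₁ g ; (k , τhk) = τ₁ h in k , Intertwines-∘ {σ} {τ} {R g} {R h} {R k} σgh τhk) ,
    (λ k → let (h , τhk) = τ₂ k ; (g , σgh) = σ₂ h in g , Intertwines-∘ {σ} {τ} {R g} {R h} {R k} σgh τhk)

  Normalises-sym : ∀ {τ} → Normalises τ → Normalises (↔-sym τ)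
  Normalises-sym {τ} (τ₁ , τ₂) =
    (λ h → let (g , τgh) = τ₂ h in g , Intertwines-sym {τ} τgh) ,
    (λ g → let (h , τgh) = τ₁ g in h , Intertwines-sym {τ} τgh)

  ActsOnBlocksAs : Perm → (Fin m → Fin m) → Set
  ActsOnBlocksAs σ p = ∀ x i → proj₂ (ap σ (x , i)) ≡ p i

  ActsOnBlocksAs-∘ : ∀ {σ τ p q} → ActsOnBlocksAs σ p → ActsOnBlocksAs τ q → ActsOnBlocksAs (τ ↔-∘ σ) (q ∘ p)
  ActsOnBlocksAs-∘ {σ} {q = q} σp τq x i =
    trans (τq (proj₁ (ap σ (x , i))) (proj₂ (ap σ (x , i)))) (cong q (σp x i))

  ActsOnBlocksAs-sym : ∀ {σ p q} → (∀ i → q (p i) ≡ i) → ActsOnBlocksAs σ p → ActsOnBlocksAs (↔-sym σ) q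
  ActsOnBlocksAs-sym {σ} {p} {q} qp≗id σp x j = begin
    proj₂ w                ≡⟨ qp≗id (proj₂ w) ⟨
    q (p (proj₂ w))        ≡⟨ cong q (σp (proj₁ w) (proj₂ w)) ⟨
    q (proj₂ (ap σ w))     ≡⟨ cong (q ∘ proj₂) (ap-apInv σ (x , j)) ⟩
    q j                    ∎
    where
      open ≡-Reasoning
      w = apInv σ (x , j)

  ActsOnBlocksAs-inverse : ∀ {σ p q} → ActsOnBlocksAs σ p → ActsOnBlocksAs (↔-sym σ) q → ∀ j → p (q j) ≡ j
  ActsOnBlocksAs-inverse {σ} {p} {q} σp σ⁻¹q j = begin
    p (q j)                        ≡⟨ cong p (σ⁻¹q ε j) ⟨
    p (proj₂ (apInv σ (ε , j)))    ≡⟨ σp _ _ ⟨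
    proj₂ (ap σ (apInv σ (ε , j))) ≡⟨ cong proj₂ (ap-apInv σ (ε , j)) ⟩
    j                              ∎
    where open ≡-Reasoning

  ActsOnBlocksAs-resp : ∀ {σ p q} → p ≗ q → ActsOnBlocksAs σ p → ActsOnBlocksAs σ q
  ActsOnBlocksAs-resp p≗q σp x i = trans (σp x i) (p≗q i)

  ActsOnBlocksAs⇒MapsOrbitsToOrbits : ∀ {σ p q} →
    ActsOnBlocksAs σ p → ActsOnBlocksAs (↔-sym σ) q → MapsOrbitsToOrbits σ
  ActsOnBlocksAs⇒MapsOrbitsToOrbits {σ} {p} {q} σp σ⁻¹q i = p i , (λ x → σp x i) , onto
    where
      onto : ∀ y → ∃ λ x → ap σ (x , i) ≡ (y , p i)
      onto y = proj₁ (apInv σ (y , p i)) ,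
        trans (cong (λ j → ap σ (proj₁ (apInv σ (y , p i)) , j)) (sym block))
              (ap-apInv σ (y , p i))
        where
          block : proj₂ (apInv σ (y , p i)) ≡ i
          block = trans (σ⁻¹q y (p i)) (ActsOnBlocksAs-inverse {↔-sym σ} σ⁻¹q σp i)

  MapsOrbitsToOrbits-injective : ∀ {f} (f-orbits : MapsOrbitsToOrbits f) {i l} →
    proj₁ (f-orbits i) ≡ proj₁ (f-orbits l) → i ≡ l
  MapsOrbitsToOrbits-injective {f} f-orbits {i} {l} same =
    let (x , fxl≡fεi) = proj₂ (proj₂ (f-orbits l)) (proj₁ (ap f (ε , i)))
        fεi-block = trans (proj₁ (proj₂ (f-orbits i)) ε) same
    in cong proj₂ (begin
      (ε , i)                    ≡⟨ apInv-ap f (ε , i) ⟨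
      apInv f (ap f (ε , i))     ≡⟨ cong (λ j → apInv f (_ , j)) fεi-block ⟩
      apInv f (_ , _)            ≡⟨ cong (apInv f) fxl≡fεi ⟨
      apInv f (ap f (x , l))     ≡⟨ apInv-ap f (x , l) ⟩
      (x , l)                    ∎)
    where open ≡-Reasoning

  -- R(G) is transitive on each block, so a normaliser permutes the blocks.
  Normalises⇒ActsOnBlocks : ∀ {ρ} → Normalises ρ → ActsOnBlocksAs ρ (λ i → proj₂ (ap ρ (ε , i)))
  Normalises⇒ActsOnBlocks {ρ} (ρ₁ , _) x i =
    trans (cong (λ y → proj₂ (ap ρ (y , i))) (sym (identityˡ x)))
          (cong proj₂ (proj₂ (ρ₁ x) (ε , i)))

  blockPermutation : ∀ ρ → Normalises ρ → Permutation′ m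
  blockPermutation ρ ρ-norm = mk↔ₛ′ (λ i → proj₂ (ap ρ (ε , i))) (λ j → proj₂ (apInv ρ (ε , j)))
    (ActsOnBlocksAs-inverse {ρ} ρ-blocks ρ⁻¹-blocks)
    (ActsOnBlocksAs-inverse {↔-sym ρ} ρ⁻¹-blocks ρ-blocks)
    where
      ρ-blocks = Normalises⇒ActsOnBlocks {ρ} ρ-norm
      ρ⁻¹-blocks = Normalises⇒ActsOnBlocks {↔-sym ρ} (Normalises-sym {ρ} ρ-norm)

  normalisingIso⇒kernelIso : ∀ {S T ρ} → InducesFullSym S → IsIso S T ρ → Normalises ρ →
    ∃ λ k → InK k × ImageIs S k T
  normalisingIso⇒kernelIso {S} {T} {ρ} fullSym ρ-iso ρ-norm =
    let (σ , σ-aut , σ-norm , σ-blocks) = fullSym π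
        ρσ⁻¹-blocks = ActsOnBlocksAs-∘ {↔-sym σ} {ρ}
          (ActsOnBlocksAs-sym {σ} (λ _ → Permutation.inverseˡ π) σ-blocks)
          (Normalises⇒ActsOnBlocks {ρ} ρ-norm)
    in ρ ↔-∘ ↔-sym σ ,
       (Normalises-∘ {↔-sym σ} {ρ} (Normalises-sym {σ} σ-norm) ρ-norm ,
        ActsOnBlocksAs-resp {ρ ↔-∘ ↔-sym σ} (λ _ → Permutation.inverseʳ π) ρσ⁻¹-blocks) ,
       IsIso-∘ {S} {S} {T} {↔-sym σ} {ρ} (IsIso-sym {S} {S} {σ} σ-aut) ρ-iso
    where π = blockPermutation ρ ρ-norm

  relabel : Permutation′ m → Perm
  relabel π = mk↔ₛ′ (λ (x , i) → x , π ⟨$⟩ʳ i) (λ (x , j) → x , π ⟨$⟩ˡ j)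
    (λ (x , j) → cong (x ,_) (Permutation.inverseʳ π))
    (λ (x , i) → cong (x ,_) (Permutation.inverseˡ π))

  relabelConn : Permutation′ m → Conn → Conn
  relabelConn π S i j = S (π ⟨$⟩ˡ i) (π ⟨$⟩ˡ j)

  relabel-isIso : ∀ π S → IsIso S (relabelConn π S) (relabel π)
  relabel-isIso π S (x , i) (y , j) = mk⇔
    (λ { (s , s∈ , y≡sx) → s , subst₂ (λ a b → s ∈ S a b) (sym π⁻¹π) (sym π⁻¹π) s∈ , y≡sx })
    (λ { (s , s∈ , y≡sx) → s , subst₂ (λ a b → s ∈ S a b) π⁻¹π π⁻¹π s∈ , y≡sx })
    where
      π⁻¹π : ∀ {i} → π ⟨$⟩ˡ (π ⟨$⟩ʳ i) ≡ i
      π⁻¹π = Permutation.inverseˡ π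

  relabel-normalises : ∀ π → Normalises (relabel π)
  relabel-normalises π = (λ g → g , λ _ → refl) , (λ h → h , λ _ → refl)

  KmPCI⇒InducesFullSym : ∀ {S} → IsPCayley S → KmPCI S → InducesFullSym S
  KmPCI⇒InducesFullSym {S} pc kmpci π =
    let f = relabel π
        (k , (k-norm , k-blocks) , k-iso) =
          kmpci (relabelConn π S) (λ i → pc (π ⟨$⟩ˡ i))
                (f , relabel-isIso π S , λ i → π ⟨$⟩ʳ i , (λ _ → refl) , λ y → y , refl)
    in ↔-sym k ↔-∘ f ,
       IsIso-∘ {S} {relabelConn π S} {S} {f} {↔-sym k}
         (relabel-isIso π S) (IsIso-sym {S} {relabelConn π S} {k} k-iso) ,
       Normalises-∘ {f} {↔-sym k} (relabel-normalises π) (Normalises-sym {k} k-norm) ,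
       ActsOnBlocksAs-∘ {f} {↔-sym k} (λ _ _ → refl) (ActsOnBlocksAs-sym {k} (λ _ → refl) k-blocks)

  module SemiregularSubgroup {H : Perm → Set} (H-iso : SubgroupIsoToG H)
                             (H-semi : Semiregular H) (H-orbits : HasOrbitSet𝒢 H) where
    φ : Carrier → Perm
    φ = proj₁ H-iso

    φ-∙ : ∀ g h v → ap (φ (g ∙ h)) v ≡ ap (φ g) (ap (φ h) v)
    φ-∙ = proj₁ (proj₂ (proj₂ H-iso))

    φ-∈ : ∀ g → H (φ g)
    φ-∈ g = Equivalence.from (proj₁ (proj₂ H-iso) (φ g)) (g , λ _ → refl)

    ∈⇒φ : ∀ {σ} → H σ → ∃ λ g → φ g ≈ₚ σ
    ∈⇒φ {σ} = Equivalence.to (proj₁ (proj₂ H-iso) σ)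

    φ-ε : ∀ v → ap (φ ε) v ≡ v
    φ-ε v = sym (begin
      v                                   ≡⟨ apInv-ap (φ ε) v ⟨
      apInv (φ ε) (ap (φ ε) v)            ≡⟨ cong (λ g → apInv (φ ε) (ap (φ g) v)) (identityˡ ε) ⟨
      apInv (φ ε) (ap (φ (ε ∙ ε)) v)      ≡⟨ cong (apInv (φ ε)) (φ-∙ ε ε v) ⟩
      apInv (φ ε) (ap (φ ε) (ap (φ ε) v)) ≡⟨ apInv-ap (φ ε) _ ⟩
      ap (φ ε) v                          ∎)
      where open ≡-Reasoning

    φ-⁻¹-cancel : ∀ b v → ap (φ (b ⁻¹)) (ap (φ b) v) ≡ v
    φ-⁻¹-cancel b v =
      trans (sym (φ-∙ (b ⁻¹) b v)) (trans (cong (λ g → ap (φ g) v) (inverseˡ b)) (φ-ε v))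

    φ-blocks : ∀ h → ActsOnBlocksAs (φ h) id
    φ-blocks h x i = sym (Equivalence.to (H-orbits (x , i) _) (φ h , φ-∈ h , refl))

    φ-regular : ∀ {a b} i → ap (φ a) (ε , i) ≡ ap (φ b) (ε , i) → a ≡ b
    φ-regular {a} {b} i φa≡φb =
      sym (⁻¹-injective (inverseˡ-unique (b ⁻¹) a (φ-injective (b ⁻¹ ∙ a) ε φb⁻¹a≈φε)))
      where
        φ-injective = proj₂ (proj₂ (proj₂ H-iso))
        fixes : ap (φ (b ⁻¹ ∙ a)) (ε , i) ≡ (ε , i)
        fixes = trans (φ-∙ (b ⁻¹) a _) (trans (cong (ap (φ (b ⁻¹))) φa≡φb) (φ-⁻¹-cancel b _))
        φb⁻¹a≈φε : φ (b ⁻¹ ∙ a) ≈ₚ φ ε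
        φb⁻¹a≈φε w = trans (H-semi _ (φ-∈ _) (ε , i) fixes w) (sym (φ-ε w))

    φ-transitive : ∀ v → ∃ λ g → ap (φ g) (ε , proj₂ v) ≡ v
    φ-transitive v =
      let (σ , σ∈H , σε≡v) = Equivalence.from (H-orbits (ε , proj₂ v) v) refl
          (g , φg≈σ) = ∈⇒φ σ∈H
      in g , trans (φg≈σ _) σε≡v

    -- The inverse makes (g , i) ↦ φ(g⁻¹)(1 , i) carry the right action R to φ.
    coord : V → V
    coord (g , i) = ap (φ (g ⁻¹)) (ε , i)

    coord⁻¹ : V → V
    coord⁻¹ v = proj₁ (φ-transitive v) ⁻¹ , proj₂ v

    coord-coord⁻¹ : ∀ v → coord (coord⁻¹ v) ≡ v
    coord-coord⁻¹ v = trans (cong (λ g → ap (φ g) (ε , proj₂ v)) (⁻¹-involutive _)) (proj₂ (φ-transitive v))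

    coord⁻¹-coord : ∀ w → coord⁻¹ (coord w) ≡ w
    coord⁻¹-coord (g , i) = cong₂ _,_ (trans (cong _⁻¹ g′≡g⁻¹) (⁻¹-involutive g)) block
      where
        v = coord (g , i)
        block = φ-blocks (g ⁻¹) ε i
        g′≡g⁻¹ : proj₁ (φ-transitive v) ≡ g ⁻¹
        g′≡g⁻¹ = φ-regular i (trans (cong (λ j → ap (φ (proj₁ (φ-transitive v))) (ε , j)) (sym block))
                                    (proj₂ (φ-transitive v)))

    coordPerm : Perm
    coordPerm = mk↔ₛ′ coord coord⁻¹ coord-coord⁻¹ coord⁻¹-coord

    coord-Intertwines : ∀ h → Intertwines coordPerm (R h) (ap (φ (h ⁻¹)))
    coord-Intertwines h (y , j) = trans
      (cong (λ g → ap (φ g) (ε , j)) (⁻¹-anti-homo-∙ y h))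
      (φ-∙ (h ⁻¹) (y ⁻¹) (ε , j))

    coord-ε : ∀ i → coord (ε , i) ≡ (ε , i)
    coord-ε i = trans (cong (λ g → ap (φ g) (ε , i)) ε⁻¹≈ε) (φ-ε (ε , i))

    coordPerm-MapsOrbitsToOrbits : MapsOrbitsToOrbits (↔-sym coordPerm)
    coordPerm-MapsOrbitsToOrbits =
      ActsOnBlocksAs⇒MapsOrbitsToOrbits {↔-sym coordPerm} {id} {id} (λ _ _ → refl) (λ g → φ-blocks (g ⁻¹) ε)

    -- Σ: the digraph that coord carries onto Γ.
    pullback : Conn → Conn
    pullback S i j = preimage (λ s → proj₁ (coord (s , j))) (S i j)

    pullback-PCayley : ∀ {S} → IsPCayley S → IsPCayley (pullback S)
    pullback-PCayley pc i = trans (cong (preimage _) (pc i)) (preimage-∅ (λ s → proj₁ (coord (s , i))))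

    coord-isIso : ∀ {S} → (∀ σ → H σ → InAut S σ) → IsIso (pullback S) S coordPerm
    coord-isIso {S} H-aut (x , i) (y , j) = begin
      Arc (pullback S) (x , i) (y , j)                  ≈⟨ Arc⇔// (pullback S) ⟩
      y // x ∈ pullback S i j                           ≈⟨ ∈-preimage _ (S i j) ⟩
      proj₁ (coord (y // x , j)) ∈ S i j                ≈⟨ Arc-fromε⇔∈ S ⟨
      Arc S (ε , i) (proj₁ (coord (y // x , j)) , j)    ≡⟨ cong₂ (Arc S) (sym coord-x//x) coord-y//x-block ⟩
      Arc S (coord (x // x , i)) (coord (y // x , j))   ≡⟨ cong₂ (Arc S) (coord-Intertwines _ (x , i)) (coord-Intertwines _ (y , j)) ⟩
      Arc S (ap φx (coord (x , i))) (ap φx (coord (y , j))) ≈⟨ H-aut φx φx∈H (coord (x , i)) (coord (y , j)) ⟨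
      Arc S (coord (x , i)) (coord (y , j))             ∎
      where
        open import Relation.Binary.Reasoning.Setoid (⇔-setoid 0ℓ)
        φx = φ (x ⁻¹ ⁻¹)
        φx∈H = φ-∈ (x ⁻¹ ⁻¹)
        coord-x//x : coord (x // x , i) ≡ (ε , i)
        coord-x//x = trans (cong (λ g → coord (g , i)) (inverseʳ x)) (coord-ε i)
        coord-y//x-block : (proj₁ (coord (y // x , j)) , j) ≡ coord (y // x , j)
        coord-y//x-block = cong (proj₁ (coord (y // x , j)) ,_) (sym (φ-blocks _ ε j))

    kernelIso⇒conjugate : ∀ {S k} → (∀ σ → H σ → InAut S σ) → InK k → ImageIs S k (pullback S) →
      ∃ λ τ → InAut S τ × ConjugateToR H τ
    kernelIso⇒conjugate {S} {k} H-aut ((k₁ , k₂) , _) k-iso =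
      τ , IsIso-∘ {S} {pullback S} {S} {k} {coordPerm} k-iso (coord-isIso H-aut) , conj₁ , conj₂
      where
        τ = coordPerm ↔-∘ k
        conj₁ : ∀ σ → H σ → ∃ λ g → ∀ v → apInv τ (ap σ (ap τ v)) ≡ R g v
        conj₁ σ σ∈H =
          let (h , φh≈σ) = ∈⇒φ σ∈H
              (g , kgh) = k₂ (h ⁻¹)
          in g , Intertwines⇒conjugate {τ} {R g} {ap σ}
                   (Intertwines-respʳ {τ} {R g} {ap (φ (h ⁻¹ ⁻¹))}
                     (λ w → trans (cong (λ a → ap (φ a) w) (⁻¹-involutive h)) (φh≈σ w))
                     (Intertwines-∘ {k} {coordPerm} {R g} {R (h ⁻¹)} {ap (φ (h ⁻¹ ⁻¹))}
                       kgh (coord-Intertwines (h ⁻¹))))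
        conj₂ : ∀ g → ∃ λ σ → H σ × (∀ v → apInv τ (ap σ (ap τ v)) ≡ R g v)
        conj₂ g =
          let (h , kgh) = k₁ g
          in φ (h ⁻¹) , φ-∈ (h ⁻¹) ,
             Intertwines⇒conjugate {τ} {R g} {ap (φ (h ⁻¹))}
               (Intertwines-∘ {k} {coordPerm} {R g} {R h} {ap (φ (h ⁻¹))} kgh (coord-Intertwines h))

  KmPCI⇒SemiregularSubgroupsConjugate : ∀ {S} → IsPCayley S → KmPCI S → SemiregularSubgroupsConjugate S
  KmPCI⇒SemiregularSubgroupsConjugate {S} pc kmpci H H-aut H-iso H-semi H-orbits =
    let coord⁻¹-iso = IsIso-sym {pullback S} {S} {coordPerm} (coord-isIso H-aut)
        (k , k-K , k-iso) = kmpci (pullback S) (pullback-PCayley {S} pc)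
                              (↔-sym coordPerm , coord⁻¹-iso , coordPerm-MapsOrbitsToOrbits)
    in kernelIso⇒conjugate {S} {k} H-aut k-K k-iso
    where open SemiregularSubgroup H-iso H-semi H-orbits

  module TransportedTranslations (f : Perm) where
    ψ : Carrier → Perm
    ψ g = ↔-sym f ↔-∘ (Rp (g ⁻¹) ↔-∘ f)

    H : Perm → Set
    H σ = ∃ λ g → ψ g ≈ₚ σ

    f-Intertwines : ∀ g → Intertwines f (ap (ψ g)) (R (g ⁻¹))
    f-Intertwines g v = ap-apInv f _

    ψ-∙ : ∀ g h v → ap (ψ (g ∙ h)) v ≡ ap (ψ g) (ap (ψ h) v)
    ψ-∙ g h v = cong (apInv f) (begin
      R ((g ∙ h) ⁻¹) (ap f v)                ≡⟨ cong (λ a → R a (ap f v)) (⁻¹-anti-homo-∙ g h) ⟩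
      R (h ⁻¹ ∙ g ⁻¹) (ap f v)               ≡⟨ R-∘ (g ⁻¹) (h ⁻¹) (ap f v) ⟨
      R (g ⁻¹) (R (h ⁻¹) (ap f v))           ≡⟨ cong (R (g ⁻¹)) (f-Intertwines h v) ⟨
      R (g ⁻¹) (ap f (ap (ψ h) v))           ∎)
      where open ≡-Reasoning

    -- With m = 0 there would be no vertex at which to compare ψ g and ψ h.
    ψ-injective : Fin m → ∀ g h → ψ g ≈ₚ ψ h → g ≡ h
    ψ-injective i₀ g h ψg≈ψh = ⁻¹-injective (R-injective (ap f v)
      (trans (sym (f-Intertwines g v)) (trans (cong (ap f) (ψg≈ψh v)) (f-Intertwines h v))))
      where v = (ε , i₀)

    H-isoToG : Fin m → SubgroupIsoToG H
    H-isoToG i₀ = ψ , (λ _ → mk⇔ id id) , ψ-∙ , ψ-injective i₀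

    H-semiregular : Semiregular H
    H-semiregular σ (g , ψg≈σ) v σv≡v w = begin
      ap σ w                       ≡⟨ ψg≈σ w ⟨
      apInv f (R (g ⁻¹) (ap f w))  ≡⟨ cong (λ a → apInv f (R a (ap f w))) g⁻¹≡ε ⟩
      apInv f (R ε (ap f w))       ≡⟨ cong (apInv f) (R-ε (ap f w)) ⟩
      apInv f (ap f w)             ≡⟨ apInv-ap f w ⟩
      w                            ∎
      where
        open ≡-Reasoning
        g⁻¹≡ε : g ⁻¹ ≡ ε
        g⁻¹≡ε = R-fixes⇒≡ε (ap f v) (trans (sym (f-Intertwines g v)) (cong (ap f) (trans (ψg≈σ v) σv≡v)))

    H-orbits : MapsOrbitsToOrbits f → HasOrbitSet𝒢 H
    H-orbits f-orbits u v = mk⇔ same-orbit⇒same-block same-block⇒same-orbit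
      where
        f-blocks : ∀ w → proj₂ (ap f w) ≡ proj₁ (f-orbits (proj₂ w))
        f-blocks (x , i) = proj₁ (proj₂ (f-orbits i)) x

        same-orbit⇒same-block : (∃ λ σ → H σ × ap σ u ≡ v) → proj₂ u ≡ proj₂ v
        same-orbit⇒same-block (σ , (g , ψg≈σ) , σu≡v) = MapsOrbitsToOrbits-injective {f} f-orbits
          (trans (sym (f-blocks u)) (trans
            (cong proj₂ (sym (f-Intertwines g u)))
            (trans (cong (proj₂ ∘ ap f) (trans (ψg≈σ u) σu≡v)) (f-blocks v))))

        same-block⇒same-orbit : proj₂ u ≡ proj₂ v → ∃ λ σ → H σ × ap σ u ≡ v
        same-block⇒same-orbit u~v =
          let (a , Rafu≡fv) = R-transitive (trans (f-blocks u) (trans (cong (proj₁ ∘ f-orbits) u~v) (sym (f-blocks v))))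
          in ψ (a ⁻¹) , (a ⁻¹ , λ _ → refl) ,
             trans (cong (λ b → apInv f (R b (ap f u))) (⁻¹-involutive a))
                   (trans (cong (apInv f) Rafu≡fv) (apInv-ap f v))

    H-inAut : ∀ {S T} → IsIso S T f → ∀ σ → H σ → InAut S σ
    H-inAut {S} {T} f-iso σ (g , ψg≈σ) = IsIso-resp-≈ₚ {S} {S} {ψ g} {σ} ψg≈σ
      (IsIso-∘ {S} {T} {S} {Rp (g ⁻¹) ↔-∘ f} {↔-sym f}
        (IsIso-∘ {S} {T} {T} {f} {Rp (g ⁻¹)} f-iso (Rp-inAut T (g ⁻¹)))
        (IsIso-sym {S} {T} {f} f-iso))

    conjugate⇒Normalises : ∀ {τ} → ConjugateToR H τ → Normalises (f ↔-∘ τ)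
    conjugate⇒Normalises {τ} (conj₁ , conj₂) =
      (λ g → let (σ , (h , ψh≈σ) , τ⁻¹στ≡Rg) = conj₂ g
             in h ⁻¹ , Intertwines-∘ {τ} {f} {R g} {ap (ψ h)} {R (h ⁻¹)}
                  (Intertwines-respʳ {τ} {R g} {ap σ} (λ w → sym (ψh≈σ w))
                    (conjugate⇒Intertwines {τ} {R g} {ap σ} τ⁻¹στ≡Rg))
                  (f-Intertwines h)) ,
      (λ h → let (g , τ⁻¹ψτ≡Rg) = conj₁ (ψ (h ⁻¹)) (h ⁻¹ , λ _ → refl)
             in g , Intertwines-∘ {τ} {f} {R g} {ap (ψ (h ⁻¹))} {R h}
                  (conjugate⇒Intertwines {τ} {R g} {ap (ψ (h ⁻¹))} τ⁻¹ψτ≡Rg)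
                  (Intertwines-respʳ {f} {_} {R (h ⁻¹ ⁻¹)}
                    (λ w → cong (λ a → R a w) (⁻¹-involutive h)) (f-Intertwines (h ⁻¹))))

  conjugacy⇒KmPCI : ∀ {S} → Fin m → InducesFullSym S → SemiregularSubgroupsConjugate S → KmPCI S
  conjugacy⇒KmPCI {S} i₀ fullSym conj T _ (f , f-iso , f-orbits) =
    let (τ , τ-aut , τ-conj) = conj H (H-inAut {S} {T} f-iso) (H-isoToG i₀) H-semiregular (H-orbits f-orbits)
    in normalisingIso⇒kernelIso {S} {T} {f ↔-∘ τ} fullSym
         (IsIso-∘ {S} {S} {T} {τ} {f} τ-aut f-iso) (conjugate⇒Normalises {τ} τ-conj)
    where open TransportedTranslations f

theorem2p4 : (G : FinGroup) (m : ℕ) → 1 < m →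
    (S : Cayley.Conn G m) → Cayley.IsPCayley G m S →
    Cayley.KmPCI G m S ⇔
      (Cayley.InducesFullSym G m S × Cayley.SemiregularSubgroupsConjugate G m S)
theorem2p4 G (suc m) _ S pc = mk⇔
  (λ kmpci → KmPCI⇒InducesFullSym pc kmpci , KmPCI⇒SemiregularSubgroupsConjugate pc kmpci)
  (λ (fullSym , conj) → conjugacy⇒KmPCI zero fullSym conj)
  where open CayleyDigraphs G (suc m)
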